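{- Let $a$ and $b$ be positive, relatively prime integers and let $S=\{a,b\}$. For an integer $d$, the following are equivalent: (i) $d$ is a dead end in $\mathbb{Z}$ with respect to $S$; (ii) $d$ is a maximal (in the Cayley order) Frobenius value with respect to $S$, i.e., $d$ is a Frobenius value and there is no Frobenius value $d'\neq d$ with $d\le d'$ in the Cayley order.
   Context: For a finite generating set $S$ of $\mathbb{Z}$, the word length $\ell(n)$ of $n\in\mathbb{Z}$ is the least $k$ such that $n=s_1+\dots+s_k$ with each $s_i\in S\cup(-S)$; equivalently it is the graph distance from $0$ to $n$ in the Cayley graph $\Gamma(\mathbb{Z},S)$, whose vertices are the integers and where $m,n$ are adjacent iff $m-n\in S\cup(-S)$. A dead end with respect to $S$ is an integer $d$ with $\ell(d+s)\le \ell(d)$ for every $s\in S\cup(-S)$. The Cayley order is the partial order on $\mathbb{Z}$ with $g\le h$ iff some geodesic path in $\Gamma(\mathbb{Z},S)$ from $0$ to $h$ passes through $g$. For a set $S$ of positive integers with greatest common divisor $1$, an integer $n$ is positively generated if it is a non-negative integer linear combination of elements of $S$, negatively generated if it is a non-positive integer linear combination of elements of $S$, and a Frobenius value with respect to $S$ otherwise. -}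

module Defs where

open import Data.Nat using (ℕ)
open import Data.Integer using (ℤ; +_; -_; _+_; _*_; _-_)
open import Data.List using (List; []; _∷_; length; take; foldr)
open import Data.List.Relation.Unary.All using (All)
open import Data.Product using (Σ; ∃; _×_; _,_)
open import Data.Sum using (_⊎_)
open import Relation.Binary.PropositionalEquality using (_≡_; _≢_)
open import Relation.Nullary using (¬_)

sumℤ : List ℤ → ℤ
sumℤ = foldr _+_ (+ 0)

data Gen (a b : ℕ) : ℤ → Set where
  +a : Gen a b (+ a)
  +b : Gen a b (+ b)
  -a : Gen a b (- (+ a))
  -b : Gen a b (- (+ b))

HasWord : ℕ → ℕ → ℕ → ℤ → Set
HasWord a b k n = Σ (List ℤ) λ ws → All (Gen a b) ws × length ws ≡ k × sumℤ ws ≡ n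

WordLength : ℕ → ℕ → ℤ → ℕ → Set
WordLength a b n k = HasWord a b k n × (∀ j → HasWord a b j n → k Data.Nat.≤ j)

DeadEnd : ℕ → ℕ → ℤ → Set
DeadEnd a b d = ∀ s → Gen a b s → ∀ k k' →
  WordLength a b d k → WordLength a b (d + s) k' → k' Data.Nat.≤ k

-- Cayley order: g ≤ h iff some geodesic path from 0 to h passes through g,
-- i.e. there is a word ws of minimal length summing to h, some prefix of
-- which sums to g.
CayleyLe : ℕ → ℕ → ℤ → ℤ → Set
CayleyLe a b g h = Σ (List ℤ) λ ws → All (Gen a b) ws × sumℤ ws ≡ h ×
  WordLength a b h (length ws) × ∃ λ i → sumℤ (take i ws) ≡ g

PosGen : ℕ → ℕ → ℤ → Set
PosGen a b n = ∃ λ x → ∃ λ y → n ≡ (+ x) * (+ a) + (+ y) * (+ b)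

NegGen : ℕ → ℕ → ℤ → Set
NegGen a b n = ∃ λ x → ∃ λ y → n ≡ - ((+ x) * (+ a) + (+ y) * (+ b))

Frobenius : ℕ → ℕ → ℤ → Set
Frobenius a b n = ¬ PosGen a b n × ¬ NegGen a b n

MaximalFrobenius : ℕ → ℕ → ℤ → Set
MaximalFrobenius a b d = Frobenius a b d ×
  (∀ d' → Frobenius a b d' → d' ≢ d → ¬ CayleyLe a b d d')

{-# OPTIONS --safe #-}
-- Suppose n = x a − y b = Y b − X a with x + X = b and y + Y = a. By coprimality, two ways of
-- writing n as a combination of a and b differ by a multiple of (b, −a), so a shortest word
-- for n has length min (x + y) (X + Y), and n is a Frobenius value exactly when such x, y, X, Y
-- exist and are all positive. The steps +a and −b move (x + y, X + Y) to (x + y + 1, X + Y − 1),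
-- while −a and +b move it the other way. Hence a Frobenius value whose two sums differ by at most
-- one is a dead end, and one whose sums differ by more has a longer Frobenius neighbour, which
-- lies above it in the Cayley order. Conversely, no geodesic can pass through a dead end, so dead
-- ends are Cayley-maximal; and a positively generated n is not a dead end, because a step by the
-- larger generator makes it longer. Negation, which swaps (x, y) with (X, Y), reduces the
-- remaining cases (negatively generated values, the steps −a and +b) to these.
module Submission where

open import Defs
open import Data.Nat using (ℕ; _<_)
open import Data.Nat.GCD using (gcd)
open import Data.Integer using (ℤ)
open import Relation.Binary.PropositionalEquality using (_≡_)
open import Function.Bundles using (_⇔_)

open import Data.Empty using (⊥)
open import Data.List using (List; []; _∷_; _++_; length; map; take; drop)
open import Data.List.Properties
  using (length-++; length-map; take-map; take++drop≡id; ++-assoc; ++-identityʳ)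
open import Data.List.Relation.Unary.All as All using (All; []; _∷_)
open import Data.List.Relation.Unary.All.Properties using (++⁺; ++⁻ˡ; ++⁻ʳ; map⁺)
open import Data.Nat using (zero; suc; _+_; _*_; _≤_; _⊓_; _≤?_; z≤n; s≤s; z<s; >-nonZero)
open import Data.Nat.Properties
open import Data.Nat.Coprimality as Coprime using (Coprime; coprime-divisor; gcd≡1⇒coprime)
open import Data.Nat.Divisibility using (divides; ∣⇒≤)
open import Data.Nat.Induction using (<-rec)
open import Data.Integer as ℤ using (+_; -[1+_]; _⊖_; 0ℤ)
import Data.Integer.Properties as ℤ
open import Data.Integer.DivMod using (_%ℕ_; _/ℕ_; a≡a%ℕn+[a/ℕn]*n; n%ℕd<d)
import Data.Integer.Tactic.RingSolver as ℤ-Solver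
import Data.Nat.Tactic.RingSolver as ℕ-Solver
open import Data.Product using (∃; ∃-syntax; _×_; _,_; proj₁; proj₂)
open import Data.Sum using (_⊎_; inj₁; inj₂; [_,_]′)
open import Function.Base using (_∘_)
open import Function.Bundles using (mk⇔)
open import Relation.Binary.PropositionalEquality
  using (_≢_; refl; sym; trans; cong; cong₂; subst; subst₂; module ≡-Reasoning)
open import Relation.Nullary using (¬_; Dec; yes; no; contradiction)
open import Relation.Nullary.Decidable using (map′; _⊎-dec_)
open import Relation.Unary using (Pred; Decidable)
open import Algebra.Properties.AbelianGroup ℤ.+-0-abelianGroup using (∙-cancelˡ; identityʳ-unique)

private
  variable
    a b j k k′ p q r s p′ r′ x y X Y : ℕ
    g m n : ℤ

m+[n+o]≡n+[m+o] : ∀ m n o → m + (n + o) ≡ n + (m + o)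
m+[n+o]≡n+[m+o] = ℕ-Solver.solve-∀

m⊖n+[n+o]≡m+o : ∀ m n o → m ⊖ n ℤ.+ + (n + o) ≡ + (m + o)
m⊖n+[n+o]≡m+o m n o = begin
  m ⊖ n ℤ.+ + (n + o)        ≡⟨ ℤ.distribˡ-⊖-+-pos (n + o) m n ⟩
  (m + (n + o)) ⊖ n          ≡⟨ cong₂ _⊖_ (m+[n+o]≡n+[m+o] m n o) (sym (+-identityʳ n)) ⟩
  (n + (m + o)) ⊖ (n + 0)    ≡⟨ ℤ.+-cancelˡ-⊖ n (m + o) 0 ⟩
  + (m + o)                  ∎
  where open ≡-Reasoning

⊖≡⊖⇒+≡+ : ∀ {m n m′ n′} → m ⊖ n ≡ m′ ⊖ n′ → m + n′ ≡ m′ + n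
⊖≡⊖⇒+≡+ {m} {n} {m′} {n′} eq = ℤ.+-injective (begin
  + (m + n′)             ≡⟨ m⊖n+[n+o]≡m+o m n n′ ⟨
  m ⊖ n ℤ.+ + (n + n′)   ≡⟨ cong₂ ℤ._+_ eq (cong +_ (+-comm n n′)) ⟩
  m′ ⊖ n′ ℤ.+ + (n′ + n) ≡⟨ m⊖n+[n+o]≡m+o m′ n′ n ⟩
  + (m′ + n)             ∎)
  where open ≡-Reasoning

+≡+⇒⊖≡⊖ : ∀ {m n m′ n′} → m + n′ ≡ m′ + n → m ⊖ n ≡ m′ ⊖ n′
+≡+⇒⊖≡⊖ {m} {n} {m′} {n′} eq = begin
  m ⊖ n                ≡⟨ ℤ.+-cancelˡ-⊖ n′ m n ⟨
  (n′ + m) ⊖ (n′ + n)  ≡⟨ cong₂ _⊖_ (trans (+-comm n′ m) (trans eq (+-comm m′ n))) (+-comm n′ n) ⟩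
  (n + m′) ⊖ (n + n′)  ≡⟨ ℤ.+-cancelˡ-⊖ n m′ n′ ⟩
  m′ ⊖ n′              ∎
  where open ≡-Reasoning

-m+[n⊖o]≡n⊖[m+o] : ∀ m n o → ℤ.- (+ m) ℤ.+ (n ⊖ o) ≡ n ⊖ (m + o)
-m+[n⊖o]≡n⊖[m+o] m n o = begin
  ℤ.- (+ m) ℤ.+ (n ⊖ o)      ≡⟨ cong (ℤ._+_ (ℤ.- (+ m))) (ℤ.⊖-swap n o) ⟩
  ℤ.- (+ m) ℤ.+ ℤ.- (o ⊖ n)  ≡⟨ ℤ.neg-distrib-+ (+ m) (o ⊖ n) ⟨
  ℤ.- (+ m ℤ.+ (o ⊖ n))      ≡⟨ cong ℤ.-_ (ℤ.distribʳ-⊖-+-pos m o n) ⟩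
  ℤ.- ((m + o) ⊖ n)          ≡⟨ ℤ.⊖-swap n (m + o) ⟨
  n ⊖ (m + o)                ∎
  where open ≡-Reasoning

pos-lincomb : ∀ a b x y → + (x * a + y * b) ≡ + x ℤ.* + a ℤ.+ + y ℤ.* + b
pos-lincomb a b x y = trans (ℤ.pos-+ (x * a) (y * b)) (cong₂ ℤ._+_ (ℤ.pos-* x a) (ℤ.pos-* y b))

-- Coprime linear combinations

coprime-*≡*⇒≤ : Coprime a b → k * a ≡ j * b → 0 < k → b ≤ k
coprime-*≡*⇒≤ {a} {b} {suc k} {j} coprime eq _ =
  ∣⇒≤ (coprime-divisor (Coprime.sym coprime) (divides j (trans (*-comm a (suc k)) eq)))

lincomb-cancel-≤ : 0 < b → p′ ≤ p → p * a + r * b ≡ p′ * a + r′ * b → r ≤ r′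
lincomb-cancel-≤ {b} {p′} {p} {a} {r} {r′} 0<b p′≤p eq =
  *-cancelʳ-≤ r r′ b {{>-nonZero 0<b}} (+-cancelˡ-≤ (p′ * a) _ _ (begin
    p′ * a + r * b  ≤⟨ +-monoˡ-≤ (r * b) (*-monoˡ-≤ a p′≤p) ⟩
    p * a + r * b   ≡⟨ eq ⟩
    p′ * a + r′ * b ∎))
  where open ≤-Reasoning

coprime-gap : Coprime a b → 0 < a → 0 < b → 0 < k →
  r * b ≡ k * a + r′ * b → b ≤ k × r′ + a ≤ r
coprime-gap {a} {b} {k} {r} {r′} coprime 0<a@z<s 0<b 0<k@z<s eq
  with f , refl ← m≤n⇒∃[o]m+o≡n {r′} {r}
                    (lincomb-cancel-≤ {p′ = 0} {p = k} {a = a} 0<b z≤n (sym eq))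
  = coprime-*≡*⇒≤ {k = k} {j = f} coprime (sym f*b≡k*a) 0<k
  , +-monoʳ-≤ r′ (coprime-*≡*⇒≤ {k = f} {j = k} (Coprime.sym coprime) f*b≡k*a (positive f f*b≡k*a))
  where
  f*b≡k*a : f * b ≡ k * a
  f*b≡k*a = +-cancelˡ-≡ (r′ * b) _ _
    (trans (sym (*-distribʳ-+ b r′ f)) (trans eq (+-comm (k * a) (r′ * b))))
  positive : ∀ f → f * b ≡ k * a → 0 < f
  positive (suc _) _ = z<s

coprime-exchange : Coprime a b → 0 < a → 0 < b →
  p * a + r * b ≡ p′ * a + r′ * b → p < p′ → p + b ≤ p′ × r′ + a ≤ r
coprime-exchange {a} {b} {p} {r} {p′} {r′} coprime 0<a 0<b eq p<p′
  with e , refl ← m≤n⇒∃[o]m+o≡n p<p′ = shift (coprime-gap coprime 0<a 0<b z<s r*b≡)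
  where
  rearrange : ∀ p e a r′ b → (suc p + e) * a + r′ * b ≡ p * a + (suc e * a + r′ * b)
  rearrange = ℕ-Solver.solve-∀
  r*b≡ : r * b ≡ suc e * a + r′ * b
  r*b≡ = +-cancelˡ-≡ (p * a) _ _ (trans eq (rearrange p e a r′ b))
  shift : b ≤ suc e × r′ + a ≤ r → p + b ≤ suc p + e × r′ + a ≤ r
  shift (b≤1+e , r′+a≤r) = subst (p + b ≤_) (+-suc p e) (+-monoʳ-≤ p b≤1+e) , r′+a≤r

-- Words and geodesics

sumℤ-++ : ∀ xs ys → sumℤ (xs ++ ys) ≡ sumℤ xs ℤ.+ sumℤ ys
sumℤ-++ []       ys = sym (ℤ.+-identityˡ (sumℤ ys))
sumℤ-++ (x ∷ xs) ys = trans (cong (ℤ._+_ x) (sumℤ-++ xs ys)) (sym (ℤ.+-assoc x (sumℤ xs) (sumℤ ys)))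

sumℤ-map-neg : ∀ ws → sumℤ (map ℤ.-_ ws) ≡ ℤ.- sumℤ ws
sumℤ-map-neg []       = refl
sumℤ-map-neg (w ∷ ws) =
  trans (cong (ℤ._+_ (ℤ.- w)) (sumℤ-map-neg ws)) (sym (ℤ.neg-distrib-+ w (sumℤ ws)))

take-length-++ : ∀ {A : Set} (xs ys : List A) → take (length xs) (xs ++ ys) ≡ xs
take-length-++ []       ys = refl
take-length-++ (x ∷ xs) ys = cong (x ∷_) (take-length-++ xs ys)

Gen-neg : Gen a b g → Gen a b (ℤ.- g)
Gen-neg +a = -a
Gen-neg +b = -b
Gen-neg {a} {b} -a = subst (Gen a b) (sym (ℤ.neg-involutive (+ a))) +a
Gen-neg {a} {b} -b = subst (Gen a b) (sym (ℤ.neg-involutive (+ b))) +b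

Gen-swap : Gen a b g → Gen b a g
Gen-swap +a = +b
Gen-swap +b = +a
Gen-swap -a = -b
Gen-swap -b = -a

Gen⇒≢0 : 0 < a → 0 < b → Gen a b g → g ≢ 0ℤ
Gen⇒≢0 z<s _   +a ()
Gen⇒≢0 z<s _   -a ()
Gen⇒≢0 _   z<s +b ()
Gen⇒≢0 _   z<s -b ()

HasWord-[] : HasWord a b 0 0ℤ
HasWord-[] = [] , [] , refl , refl

HasWord-∷ : Gen a b g → HasWord a b k n → HasWord a b (suc k) (g ℤ.+ n)
HasWord-∷ {g = g} g∈ (ws , gs , refl , refl) = g ∷ ws , g∈ ∷ gs , refl , refl

HasWord-++ : HasWord a b j m → HasWord a b k n → HasWord a b (j + k) (m ℤ.+ n)
HasWord-++ (ws , gs , refl , refl) (vs , hs , refl , refl) =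
  ws ++ vs , ++⁺ gs hs , length-++ ws , sumℤ-++ ws vs

HasWord-neg : HasWord a b k n → HasWord a b k (ℤ.- n)
HasWord-neg (ws , gs , refl , refl) =
  map ℤ.-_ ws , map⁺ (All.map Gen-neg gs) , length-map ℤ.-_ ws , sumℤ-map-neg ws

HasWord-swap : HasWord a b k n → HasWord b a k n
HasWord-swap (ws , gs , len , sum) = ws , All.map Gen-swap gs , len , sum

HasWord-step : Gen a b g → HasWord a b k (ℤ.- g ℤ.+ n) → HasWord a b (suc k) n
HasWord-step {a} {b} {g} {n = n} g∈ word =
  subst (HasWord a b _) (m+[-m+n]≡n g n) (HasWord-∷ g∈ word)
  where
  m+[-m+n]≡n : ∀ m n → m ℤ.+ (ℤ.- m ℤ.+ n) ≡ n
  m+[-m+n]≡n = ℤ-Solver.solve-∀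

HasWord-unstep : HasWord a b (suc k) n → ∃[ g ] Gen a b g × HasWord a b k (ℤ.- g ℤ.+ n)
HasWord-unstep (w ∷ ws , g∈ ∷ gs , refl , refl) = w , g∈ , ws , gs , refl , -m+[m+n]≡n w (sumℤ ws)
  where
  -m+[m+n]≡n : ∀ m n → n ≡ ℤ.- m ℤ.+ (m ℤ.+ n)
  -m+[m+n]≡n = ℤ-Solver.solve-∀

HasWord? : ∀ k n → Dec (HasWord a b k n)
HasWord? zero n =
  map′ (λ { refl → HasWord-[] }) (λ { ([] , [] , refl , sum≡n) → sym sum≡n }) (n ℤ.≟ 0ℤ)
HasWord? {a} {b} (suc k) n = map′ step unstep
  (HasWord? k (ℤ.- (+ a) ℤ.+ n) ⊎-dec HasWord? k (ℤ.- (ℤ.- (+ a)) ℤ.+ n) ⊎-dec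
   HasWord? k (ℤ.- (+ b) ℤ.+ n) ⊎-dec HasWord? k (ℤ.- (ℤ.- (+ b)) ℤ.+ n))
  where
  StepBack : Set
  StepBack = HasWord a b k (ℤ.- (+ a) ℤ.+ n) ⊎ HasWord a b k (ℤ.- (ℤ.- (+ a)) ℤ.+ n) ⊎
             HasWord a b k (ℤ.- (+ b) ℤ.+ n) ⊎ HasWord a b k (ℤ.- (ℤ.- (+ b)) ℤ.+ n)
  step : StepBack → HasWord a b (suc k) n
  step (inj₁ word)                      = HasWord-step +a word
  step (inj₂ (inj₁ word))               = HasWord-step -a word
  step (inj₂ (inj₂ (inj₁ word)))        = HasWord-step +b word
  step (inj₂ (inj₂ (inj₂ word)))        = HasWord-step -b word
  unstep : HasWord a b (suc k) n → StepBack
  unstep word with HasWord-unstep word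
  ... | _ , +a , word′ = inj₁ word′
  ... | _ , -a , word′ = inj₂ (inj₁ word′)
  ... | _ , +b , word′ = inj₂ (inj₂ (inj₁ word′))
  ... | _ , -b , word′ = inj₂ (inj₂ (inj₂ word′))

least-witness : ∀ {ℓ} {P : Pred ℕ ℓ} → Decidable P → P k → ∃[ m ] P m × (∀ j → P j → m ≤ j)
least-witness {k = k} {ℓ = ℓ} {P = P} P? = <-rec (λ k → P k → Least) search k
  where
  Least : Set ℓ
  Least = ∃[ m ] P m × (∀ j → P j → m ≤ j)
  search : ∀ k → (∀ {j} → j < k → P j → Least) → P k → Least
  search k shorter Pk with anyUpTo? P? k
  ... | yes (j , j<k , Pj) = shorter j<k Pj
  ... | no  none           = k , Pk , λ j Pj → ≮⇒≥ (λ j<k → none (j , j<k , Pj))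

WordLength-exists : HasWord a b k n → ∃ (WordLength a b n)
WordLength-exists {n = n} = least-witness (λ k → HasWord? k n)

WordLength-unique : WordLength a b n k → WordLength a b n k′ → k ≡ k′
WordLength-unique (word , shortest) (word′ , shortest′) =
  ≤-antisym (shortest _ word′) (shortest′ _ word)

WordLength-neg : WordLength a b n k → WordLength a b (ℤ.- n) k
WordLength-neg {a} {b} {n} (word , shortest) = HasWord-neg word , λ j word′ →
  shortest j (subst (HasWord a b j) (ℤ.neg-involutive n) (HasWord-neg word′))

WordLength-swap : WordLength a b n k → WordLength b a n k
WordLength-swap (word , shortest) = HasWord-swap word , λ j word′ → shortest j (HasWord-swap word′)

WordLength-step : WordLength a b n k → Gen a b g → ∃ (WordLength a b (n ℤ.+ g))
WordLength-step {a} {b} {n} {g = g} (word , _) g∈ =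
  WordLength-exists (subst (HasWord a b _) (ℤ.+-comm g n) (HasWord-∷ g∈ word))

geodesic-++ˡ : ∀ xs ys → All (Gen a b) (xs ++ ys) →
  WordLength a b (sumℤ (xs ++ ys)) (length (xs ++ ys)) → WordLength a b (sumℤ xs) (length xs)
geodesic-++ˡ {a} {b} xs ys gs (_ , shortest) = (xs , ++⁻ˡ xs gs , refl , refl) , shortest′
  where
  open ≤-Reasoning
  shortest′ : ∀ j → HasWord a b j (sumℤ xs) → length xs ≤ j
  shortest′ j word = +-cancelʳ-≤ (length ys) (length xs) j (begin
    length xs + length ys  ≡⟨ length-++ xs ⟨
    length (xs ++ ys)      ≤⟨ shortest _ (subst (HasWord a b _) (sym (sumℤ-++ xs ys))
                                (HasWord-++ word (ys , ++⁻ʳ xs gs , refl , refl))) ⟩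
    j + length ys          ∎)

CayleyLe-step : WordLength a b n k → Gen a b g → WordLength a b (n ℤ.+ g) (suc k) →
  CayleyLe a b n (n ℤ.+ g)
CayleyLe-step {a} {b} {g = g} ((ws , gs , refl , refl) , _) g∈ geodesic =
  ws ++ g ∷ [] , ++⁺ gs (g∈ ∷ []) , sum≡ ,
  subst (WordLength a b _) (trans (+-comm 1 (length ws)) (sym (length-++ ws))) geodesic ,
  length ws , cong sumℤ (take-length-++ ws (g ∷ []))
  where
  sum≡ : sumℤ (ws ++ g ∷ []) ≡ sumℤ ws ℤ.+ g
  sum≡ = trans (sumℤ-++ ws (g ∷ [])) (cong (ℤ._+_ (sumℤ ws)) (ℤ.+-identityʳ g))

CayleyLe-neg : CayleyLe a b m n → CayleyLe a b (ℤ.- m) (ℤ.- n)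
CayleyLe-neg {a} {b} (ws , gs , refl , geodesic , i , refl) =
  map ℤ.-_ ws , map⁺ (All.map Gen-neg gs) , sumℤ-map-neg ws ,
  subst (WordLength a b _) (sym (length-map ℤ.-_ ws)) (WordLength-neg geodesic) ,
  i , trans (cong sumℤ (take-map i ws)) (sumℤ-map-neg (take i ws))

-- Tallies

record Tally : Set where
  constructor tally
  field
    plus-a minus-a plus-b minus-b : ℕ

size : Tally → ℕ
size (tally p q r s) = p + q + r + s

value : ℕ → ℕ → Tally → ℤ
value a b (tally p q r s) = (p * a + r * b) ⊖ (q * a + s * b)

tick : Gen a b g → Tally → Tally
tick +a (tally p q r s) = tally (suc p) q r s
tick -a (tally p q r s) = tally p (suc q) r s
tick +b (tally p q r s) = tally p q (suc r) s
tick -b (tally p q r s) = tally p q r (suc s)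

size-tick : (g∈ : Gen a b g) → ∀ t → size (tick g∈ t) ≡ suc (size t)
size-tick +a (tally p q r s) = refl
size-tick -a (tally p q r s) = cong (λ m → m + r + s) (+-suc p q)
size-tick +b (tally p q r s) = cong (_+ s) (+-suc (p + q) r)
size-tick -b (tally p q r s) = +-suc (p + q + r) s

value-tick : (g∈ : Gen a b g) → ∀ t → value a b (tick g∈ t) ≡ g ℤ.+ value a b t
value-tick {a} {b} +a (tally p q r s) =
  trans (cong (_⊖ (q * a + s * b)) (+-assoc a (p * a) (r * b)))
        (sym (ℤ.distribʳ-⊖-+-pos a (p * a + r * b) (q * a + s * b)))
value-tick {a} {b} -a (tally p q r s) =
  trans (cong ((p * a + r * b) ⊖_) (+-assoc a (q * a) (s * b)))
        (sym (-m+[n⊖o]≡n⊖[m+o] a (p * a + r * b) (q * a + s * b)))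
value-tick {a} {b} +b (tally p q r s) =
  trans (cong (_⊖ (q * a + s * b)) (m+[n+o]≡n+[m+o] (p * a) b (r * b)))
        (sym (ℤ.distribʳ-⊖-+-pos b (p * a + r * b) (q * a + s * b)))
value-tick {a} {b} -b (tally p q r s) =
  trans (cong ((p * a + r * b) ⊖_) (m+[n+o]≡n+[m+o] (q * a) b (s * b)))
        (sym (-m+[n⊖o]≡n⊖[m+o] b (p * a + r * b) (q * a + s * b)))

HasWord⇒Tally : HasWord a b k n → ∃[ t ] size t ≡ k × value a b t ≡ n
HasWord⇒Tally {a} {b} (ws , gs , refl , refl) = count gs
  where
  count : ∀ {ws} → All (Gen a b) ws → ∃[ t ] size t ≡ length ws × value a b t ≡ sumℤ ws
  count []          = tally 0 0 0 0 , refl , refl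
  count {w ∷ _} (g∈ ∷ gs) with t , size≡ , value≡ ← count gs =
    tick g∈ t , trans (size-tick g∈ t) (cong suc size≡) ,
    trans (value-tick g∈ t) (cong (ℤ._+_ w) value≡)

HasWord-tick : (g∈ : Gen a b g) → ∀ t →
  HasWord a b (size t) (value a b t) → HasWord a b (suc (size t)) (value a b (tick g∈ t))
HasWord-tick g∈ t word = subst (HasWord _ _ _) (sym (value-tick g∈ t)) (HasWord-∷ g∈ word)

Tally⇒HasWord : ∀ t → HasWord a b (size t) (value a b t)
Tally⇒HasWord (tally 0 0 0 0)       = HasWord-[]
Tally⇒HasWord (tally (suc p) q r s) =
  HasWord-tick +a (tally p q r s) (Tally⇒HasWord (tally p q r s))
Tally⇒HasWord (tally 0 (suc q) r s) =
  HasWord-tick -a (tally 0 q r s) (Tally⇒HasWord (tally 0 q r s))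
Tally⇒HasWord (tally 0 0 (suc r) s) =
  HasWord-tick +b (tally 0 0 r s) (Tally⇒HasWord (tally 0 0 r s))
Tally⇒HasWord (tally 0 0 0 (suc s)) =
  HasWord-tick -b (tally 0 0 0 s) (Tally⇒HasWord (tally 0 0 0 s))

value-lincomb : ∀ p q r s → value a b (tally p q r s) ≡ (p ⊖ q) ℤ.* + a ℤ.+ (r ⊖ s) ℤ.* + b
value-lincomb {a} {b} p q r s = begin
  (p * a + r * b) ⊖ (q * a + s * b)
    ≡⟨ ℤ.[+m]-[+n]≡m⊖n (p * a + r * b) (q * a + s * b) ⟨
  + (p * a + r * b) ℤ.- + (q * a + s * b)
    ≡⟨ cong₂ ℤ._-_ (pos-lincomb a b p r) (pos-lincomb a b q s) ⟩
  (+ p ℤ.* + a ℤ.+ + r ℤ.* + b) ℤ.- (+ q ℤ.* + a ℤ.+ + s ℤ.* + b)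
    ≡⟨ regroup (+ p) (+ q) (+ r) (+ s) (+ a) (+ b) ⟩
  (+ p ℤ.- + q) ℤ.* + a ℤ.+ (+ r ℤ.- + s) ℤ.* + b
    ≡⟨ cong₂ (λ u v → u ℤ.* + a ℤ.+ v ℤ.* + b) (ℤ.[+m]-[+n]≡m⊖n p q) (ℤ.[+m]-[+n]≡m⊖n r s) ⟩
  (p ⊖ q) ℤ.* + a ℤ.+ (r ⊖ s) ℤ.* + b ∎
  where
  open ≡-Reasoning
  regroup : ∀ p q r s a b →
    (p ℤ.* a ℤ.+ r ℤ.* b) ℤ.- (q ℤ.* a ℤ.+ s ℤ.* b) ≡ (p ℤ.- q) ℤ.* a ℤ.+ (r ℤ.- s) ℤ.* b
  regroup = ℤ-Solver.solve-∀

HasWord⇒lincomb : HasWord a b k n → ∃[ u ] ∃[ v ] n ≡ u ℤ.* + a ℤ.+ v ℤ.* + b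
HasWord⇒lincomb word with tally p q r s , _ , refl ← HasWord⇒Tally word =
  p ⊖ q , r ⊖ s , value-lincomb p q r s

-- Dead ends are maximal Frobenius values

DeadEnd-neg : DeadEnd a b n → DeadEnd a b (ℤ.- n)
DeadEnd-neg {a} {b} {n} dead s s∈ k k′ geodesic geodesic′ = dead (ℤ.- s) (Gen-neg s∈) k k′
  (subst (λ m → WordLength a b m k) (ℤ.neg-involutive n) (WordLength-neg geodesic))
  (subst (λ m → WordLength a b m k′) -[-n+s]≡n-s (WordLength-neg geodesic′))
  where
  -[-n+s]≡n-s : ℤ.- (ℤ.- n ℤ.+ s) ≡ n ℤ.+ ℤ.- s
  -[-n+s]≡n-s = trans (ℤ.neg-distrib-+ (ℤ.- n) s) (cong (λ m → m ℤ.+ ℤ.- s) (ℤ.neg-involutive n))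

DeadEnd-geodesic-stops : DeadEnd a b n → ∀ xs w ys → All (Gen a b) (xs ++ w ∷ ys) →
  WordLength a b (sumℤ (xs ++ w ∷ ys)) (length (xs ++ w ∷ ys)) → sumℤ xs ≢ n
DeadEnd-geodesic-stops {a} {b} dead xs w ys gs geodesic refl =
  n≮n _ (dead w (All.head (++⁻ʳ xs gs)) _ _ (geodesic-++ˡ xs (w ∷ ys) gs geodesic) geodesic′)
  where
  geodesic′ : WordLength a b (sumℤ xs ℤ.+ w) (suc (length xs))
  geodesic′ = subst₂ (WordLength a b)
    (trans (sumℤ-++ xs (w ∷ [])) (cong (ℤ._+_ (sumℤ xs)) (ℤ.+-identityʳ w)))
    (trans (length-++ xs) (+-comm (length xs) 1))
    (geodesic-++ˡ (xs ++ w ∷ []) ys (subst (All (Gen a b)) (sym (++-assoc xs (w ∷ []) ys)) gs)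
      (subst (λ vs → WordLength a b (sumℤ vs) (length vs)) (sym (++-assoc xs (w ∷ []) ys))
        geodesic))

DeadEnd-maximal : DeadEnd a b n → ∀ m → m ≢ n → ¬ CayleyLe a b n m
DeadEnd-maximal {a} {b} {n} dead m m≢n (ws , gs , refl , geodesic , i , prefix) =
  split (take i ws) (drop i ws) (take++drop≡id i ws) prefix
  where
  split : ∀ xs ys → xs ++ ys ≡ ws → sumℤ xs ≡ n → ⊥
  split xs [] xs++[]≡ws sum≡n =
    m≢n (trans (cong sumℤ (trans (sym xs++[]≡ws) (++-identityʳ xs))) sum≡n)
  split xs (w ∷ ys) xs++ys≡ws = DeadEnd-geodesic-stops dead xs w ys
    (subst (All (Gen a b)) (sym xs++ys≡ws) gs)
    (subst (λ vs → WordLength a b (sumℤ vs) (length vs)) (sym xs++ys≡ws) geodesic)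

lincomb-HasWord : ∀ x y → HasWord a b (x + y) (+ x ℤ.* + a ℤ.+ + y ℤ.* + b)
lincomb-HasWord {a} {b} x y = subst₂ (HasWord a b)
  (trans (+-identityʳ (x + 0 + y)) (cong (_+ y) (+-identityʳ x))) (pos-lincomb a b x y)
  (Tally⇒HasWord (tally x 0 y 0))

PosGen-swap : PosGen a b n → PosGen b a n
PosGen-swap {a} {b} (x , y , n≡) = y , x , trans n≡ (ℤ.+-comm (+ x ℤ.* + a) (+ y ℤ.* + b))

PosGen⇒NegGen-neg : PosGen a b n → NegGen a b (ℤ.- n)
PosGen⇒NegGen-neg (x , y , n≡) = x , y , cong ℤ.-_ n≡

NegGen⇒PosGen-neg : NegGen a b n → PosGen a b (ℤ.- n)
NegGen⇒PosGen-neg (x , y , n≡) = x , y , trans (cong ℤ.-_ n≡) (ℤ.neg-involutive _)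

u*a+v*b≡r*b⇒u+v≤r : ∀ {a b u v r} → 0 < b → b ≤ a → u * a + v * b ≡ r * b → u + v ≤ r
u*a+v*b≡r*b⇒u+v≤r {a} {b} {u} {v} {r} 0<b b≤a eq = *-cancelʳ-≤ (u + v) r b {{>-nonZero 0<b}} (begin
  (u + v) * b    ≡⟨ *-distribʳ-+ b u v ⟩
  u * b + v * b  ≤⟨ +-monoˡ-≤ (v * b) (*-monoʳ-≤ u b≤a) ⟩
  u * a + v * b  ≡⟨ eq ⟩
  r * b          ∎)
  where open ≤-Reasoning

-- A word for n + a containing +a shortens to one for n; one avoiding +a needs more than x + y
-- letters +b.
PosGen-+a-lengthens : 0 < b → b ≤ a → PosGen a b n → WordLength a b n k →
  HasWord a b k′ (n ℤ.+ + a) → k < k′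
PosGen-+a-lengthens {b} {a} {k = k} 0<b b≤a (x , y , refl) (_ , shortest) word
  with HasWord⇒Tally word
... | tally (suc p) q r s , refl , value≡ =
  s≤s (shortest _ (subst (HasWord a b _) value-t≡n (Tally⇒HasWord (tally p q r s))))
  where
  value-t≡n : value a b (tally p q r s) ≡ + x ℤ.* + a ℤ.+ + y ℤ.* + b
  value-t≡n = ∙-cancelˡ (+ a) _ _ (trans (sym (value-tick {a} {b} +a (tally p q r s)))
    (trans value≡ (ℤ.+-comm (+ x ℤ.* + a ℤ.+ + y ℤ.* + b) (+ a))))
... | tally zero q r s , refl , value≡ = begin-strict
  k                  ≤⟨ shortest (x + y) (lincomb-HasWord {a} {b} x y) ⟩
  x + y              <⟨ s≤s (+-mono-≤ (m≤m+n x q) (m≤m+n y s)) ⟩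
  suc x + q + (y + s) ≤⟨ u*a+v*b≡r*b⇒u+v≤r {u = suc x + q} {v = y + s} 0<b b≤a r*b≡ ⟩
  r                  ≤⟨ m≤n+m r q ⟩
  q + r              ≤⟨ m≤m+n (q + r) s ⟩
  q + r + s          ∎
  where
  open ≤-Reasoning
  rearrange : ∀ x y q s a b → (suc x + q) * a + (y + s) * b ≡ x * a + y * b + a + (q * a + s * b)
  rearrange = ℕ-Solver.solve-∀
  value≡′ : (r * b) ⊖ (q * a + s * b) ≡ (x * a + y * b + a) ⊖ 0
  value≡′ = trans value≡ (trans (cong (λ m → m ℤ.+ + a) (sym (pos-lincomb a b x y)))
                                (sym (ℤ.pos-+ (x * a + y * b) a)))
  r*b≡ : (suc x + q) * a + (y + s) * b ≡ r * b
  r*b≡ = trans (rearrange x y q s a b) (trans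
    (sym (⊖≡⊖⇒+≡+ {r * b} {q * a + s * b} {x * a + y * b + a} {0} value≡′)) (+-identityʳ (r * b)))

DeadEnd⇒¬PosGen : 0 < a → 0 < b → DeadEnd a b n → ¬ PosGen a b n
DeadEnd⇒¬PosGen {a} {b} 0<a 0<b dead pos@(x , y , refl)
  with k , geodesic ← WordLength-exists (lincomb-HasWord {a} {b} x y) | b ≤? a
... | yes b≤a with k′ , geodesic′ ← WordLength-step geodesic +a =
  <⇒≱ (PosGen-+a-lengthens 0<b b≤a pos geodesic (proj₁ geodesic′))
      (dead (+ a) +a k k′ geodesic geodesic′)
... | no  b≰a with k′ , geodesic′ ← WordLength-step geodesic +b =
  <⇒≱ (PosGen-+a-lengthens 0<a (<⇒≤ (≰⇒> b≰a)) (PosGen-swap pos) (WordLength-swap geodesic)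
        (HasWord-swap (proj₁ geodesic′)))
      (dead (+ b) +b k k′ geodesic geodesic′)

DeadEnd⇒MaximalFrobenius : 0 < a → 0 < b → DeadEnd a b n → MaximalFrobenius a b n
DeadEnd⇒MaximalFrobenius 0<a 0<b dead =
  ( DeadEnd⇒¬PosGen 0<a 0<b dead
  , DeadEnd⇒¬PosGen 0<a 0<b (DeadEnd-neg dead) ∘ NegGen⇒PosGen-neg )
  , λ m _ → DeadEnd-maximal dead m

-- Boxes

-- n = x a − y b = Y b − X a; a shortest word for n uses either x letters +a and y letters −b,
-- or X letters −a and Y letters +b.
record IsBox (a b : ℕ) (n : ℤ) (x y X Y : ℕ) : Set where
  constructor box
  field
    x+X≡b : x + X ≡ b
    y+Y≡a : y + Y ≡ a
    n≡xa-yb : n ≡ (x * a) ⊖ (y * b)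

InteriorBox : ℕ → ℕ → ℤ → Set
InteriorBox a b n = ∃[ x ] ∃[ y ] ∃[ X ] ∃[ Y ] IsBox a b n (suc x) (suc y) (suc X) (suc Y)

box-lowerBound : Coprime a b → 0 < a → 0 < b → IsBox a b n x y X Y →
  ∀ t → value a b t ≡ n → (x + y) ⊓ (X + Y) ≤ size t
box-lowerBound {a} {b} {x = x} {y = y} {X = X} {Y = Y} coprime 0<a 0<b (box x+X≡b y+Y≡a refl)
  (tally p q r s) value≡ = [ many-a , few-a ]′ (≤-<-connex (x + q) p)
  where
  regroup : ∀ p q r s x y a b → p * a + r * b + y * b ≡ x * a + (q * a + s * b) →
            p * a + (r + y) * b ≡ (x + q) * a + s * b
  regroup p q r s x y a b eq = trans (lhs p r y a b) (trans eq (rhs x q s a b))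
    where
    lhs : ∀ p r y a b → p * a + (r + y) * b ≡ p * a + r * b + y * b
    lhs = ℕ-Solver.solve-∀
    rhs : ∀ x q s a b → x * a + (q * a + s * b) ≡ (x + q) * a + s * b
    rhs = ℕ-Solver.solve-∀
  eq : p * a + (r + y) * b ≡ (x + q) * a + s * b
  eq = regroup p q r s x y a b (⊖≡⊖⇒+≡+ {p * a + r * b} {q * a + s * b} {x * a} {y * b} value≡)
  many-a : x + q ≤ p → (x + y) ⊓ (X + Y) ≤ p + q + r + s
  many-a x+q≤p = ≤-trans (m⊓n≤m (x + y) (X + Y)) (+-mono-≤ x≤p+q+r y≤s)
    where
    y≤s : y ≤ s
    y≤s = ≤-trans (m≤n+m y r) (lincomb-cancel-≤ {r = r + y} {r′ = s} 0<b x+q≤p eq)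
    x≤p+q+r : x ≤ p + q + r
    x≤p+q+r = ≤-trans (m≤m+n x q) (≤-trans x+q≤p (≤-trans (m≤m+n p q) (m≤m+n (p + q) r)))
  few-a : p < x + q → (x + y) ⊓ (X + Y) ≤ p + q + r + s
  few-a p<x+q = ≤-trans (m⊓n≤n (x + y) (X + Y))
    (≤-trans (+-mono-≤ (≤-trans X≤q (m≤n+m q p)) Y≤r) (m≤m+n (p + q + r) s))
    where
    exchanged : p + b ≤ x + q × s + a ≤ r + y
    exchanged = coprime-exchange coprime 0<a 0<b eq p<x+q
    X≤q : X ≤ q
    X≤q = +-cancelˡ-≤ x X q (≤-trans (m≤n+m (x + X) p)
      (subst (λ b → p + b ≤ x + q) (sym x+X≡b) (proj₁ exchanged)))
    Y≤r : Y ≤ r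
    Y≤r = +-cancelˡ-≤ y Y r (≤-trans (m≤n+m (y + Y) s)
      (subst₂ (λ a c → s + a ≤ c) (sym y+Y≡a) (+-comm r y) (proj₂ exchanged)))

box-wordLength : Coprime a b → 0 < a → 0 < b → IsBox a b n x y X Y →
  WordLength a b n ((x + y) ⊓ (X + Y))
box-wordLength {a} {b} {n} {x} {y} {X} {Y} coprime 0<a 0<b is-box@(box x+X≡b y+Y≡a n≡) =
  word (⊓-sel (x + y) (X + Y)) , shortest
  where
  word₁ : HasWord a b (x + y) n
  word₁ = subst₂ (HasWord a b) (cong (_+ y) (trans (+-identityʳ (x + 0)) (+-identityʳ x)))
    (trans (cong (_⊖ (y * b)) (+-identityʳ (x * a))) (sym n≡)) (Tally⇒HasWord (tally x 0 0 y))
  identity : ∀ x X y Y → Y * (x + X) + y * (x + X) ≡ x * (y + Y) + (X * (y + Y) + 0)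
  identity = ℕ-Solver.solve-∀
  word₂ : HasWord a b (X + Y) n
  word₂ = subst₂ (HasWord a b) (+-identityʳ (X + Y))
    (trans (+≡+⇒⊖≡⊖ {Y * b} {X * a + 0} {x * a} {y * b}
              (subst₂ (λ a b → Y * b + y * b ≡ x * a + (X * a + 0)) y+Y≡a x+X≡b (identity x X y Y)))
           (sym n≡))
    (Tally⇒HasWord (tally 0 X Y 0))
  word : (x + y) ⊓ (X + Y) ≡ x + y ⊎ (x + y) ⊓ (X + Y) ≡ X + Y → HasWord a b ((x + y) ⊓ (X + Y)) n
  word (inj₁ min≡) = subst (λ k → HasWord a b k n) (sym min≡) word₁
  word (inj₂ min≡) = subst (λ k → HasWord a b k n) (sym min≡) word₂
  shortest : ∀ j → HasWord a b j n → (x + y) ⊓ (X + Y) ≤ j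
  shortest j word′ with t , refl , value≡ ← HasWord⇒Tally word′ =
    box-lowerBound coprime 0<a 0<b is-box t value≡

IsBox-+a : IsBox a b n x y (suc X) Y → IsBox a b (n ℤ.+ + a) (suc x) y X Y
IsBox-+a {a} {b} {x = x} {y} {X} (box x+X≡b y+Y≡a refl) = box
  (trans (sym (+-suc x X)) x+X≡b) y+Y≡a
  (trans (ℤ.distribˡ-⊖-+-pos a (x * a) (y * b)) (cong (_⊖ (y * b)) (+-comm (x * a) a)))

IsBox--b : IsBox a b n x y X (suc Y) → IsBox a b (n ℤ.+ ℤ.- (+ b)) x (suc y) X Y
IsBox--b {a} {b} {x = x} {y} {Y = Y} (box x+X≡b y+Y≡a refl) = box
  x+X≡b (trans (sym (+-suc y Y)) y+Y≡a)
  (trans (ℤ.+-comm ((x * a) ⊖ (y * b)) (ℤ.- (+ b))) (-m+[n⊖o]≡n⊖[m+o] b (x * a) (y * b)))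

IsBox⇒Frobenius : Coprime a b → IsBox a b n (suc x) (suc y) (suc X) (suc Y) → Frobenius a b n
IsBox⇒Frobenius {a} {b} {x = x} {y} {X} {Y} coprime (box x+X≡b y+Y≡a refl) = ¬pos , ¬neg
  where
  0<a : 0 < a
  0<a = subst (0 <_) y+Y≡a z<s
  0<b : 0 < b
  0<b = subst (0 <_) x+X≡b z<s
  x<b : suc x < b
  x<b = subst (suc x <_) x+X≡b (m<m+n (suc x) z<s)
  y<a : suc y < a
  y<a = subst (suc y <_) y+Y≡a (m<m+n (suc y) z<s)
  ¬pos : ¬ PosGen a b ((suc x * a) ⊖ (suc y * b))
  ¬pos (P , Q , n≡) = [ many-a , few-a ]′ (≤-<-connex (suc x) P)
    where
    regroup : ∀ P Q y a b → P * a + (Q + y) * b ≡ P * a + Q * b + y * b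
    regroup = ℕ-Solver.solve-∀
    eq : P * a + (Q + suc y) * b ≡ suc x * a + 0 * b
    eq = trans (regroup P Q (suc y) a b) (sym (⊖≡⊖⇒+≡+ {suc x * a} {suc y * b} {P * a + Q * b} {0}
      (trans n≡ (sym (pos-lincomb a b P Q)))))
    many-a : suc x ≤ P → ⊥
    many-a x<P = contradiction (≤-trans (m≤n+m (suc y) Q)
      (lincomb-cancel-≤ {r = Q + suc y} {r′ = 0} 0<b x<P eq)) λ ()
    few-a : P < suc x → ⊥
    few-a P<x = <⇒≱ x<b (≤-trans (m≤n+m b P)
      (proj₁ (coprime-exchange {p = P} {r = Q + suc y} {p′ = suc x} {r′ = 0}
                coprime 0<a 0<b eq P<x)))
  ¬neg : ¬ NegGen a b ((suc x * a) ⊖ (suc y * b))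
  ¬neg (P , Q , n≡) = <⇒≱ y<a (≤-trans (m≤n+m a Q)
    (proj₂ (coprime-exchange {p = 0} {r = suc y} {p′ = suc x + P} {r′ = Q} coprime 0<a 0<b eq z<s)))
    where
    regroup : ∀ x P Q a b → (x + P) * a + Q * b ≡ x * a + (P * a + Q * b)
    regroup = ℕ-Solver.solve-∀
    eq : 0 * a + suc y * b ≡ (suc x + P) * a + Q * b
    eq = sym (trans (regroup (suc x) P Q a b) (⊖≡⊖⇒+≡+ {suc x * a} {suc y * b} {0} {P * a + Q * b}
      (trans n≡ (trans (cong ℤ.-_ (sym (pos-lincomb a b P Q)))
                       (sym (ℤ.⊖-swap 0 (P * a + Q * b)))))))

<⇒∃-+-suc : ∀ {m n} → m < n → ∃[ o ] m + suc o ≡ n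
<⇒∃-+-suc {m} m<n with o , m+o≡n ← m≤n⇒∃[o]m+o≡n m<n = o , trans (+-suc m o) m+o≡n

⊖⇒NegGen : ∀ {a b x y} → n ≡ 0 ⊖ (x * a + y * b) → NegGen a b n
⊖⇒NegGen {a = a} {b} {x} {y} n≡ =
  x , y , trans n≡ (trans (ℤ.⊖-swap 0 (x * a + y * b)) (cong ℤ.-_ (pos-lincomb a b x y)))

xa-yb⇒InteriorBox : ¬ NegGen a b n → x < b → n ≡ (x * a) ⊖ (suc y * b) → InteriorBox a b n
xa-yb⇒InteriorBox {x = zero} {y = y} ¬neg _ n≡ =
  contradiction (⊖⇒NegGen {x = 0} {y = suc y} n≡) ¬neg
xa-yb⇒InteriorBox {a} {b} {x = suc x} {y} ¬neg x<b n≡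
  with X , refl ← <⇒∃-+-suc x<b | a ≤? suc y
... | yes a≤1+y with e , a+e≡1+y ← m≤n⇒∃[o]m+o≡n a≤1+y =
  contradiction (⊖⇒NegGen {x = suc X} {y = e} (trans n≡ (+≡+⇒⊖≡⊖ {suc x * a} {suc y * b}
    (subst (λ c → suc x * a + (suc X * a + e * b) ≡ c * b) a+e≡1+y
      (identity (suc x) (suc X) a e))))) ¬neg
  where
  identity : ∀ x X a e → x * a + (X * a + e * (x + X)) ≡ (a + e) * (x + X)
  identity = ℕ-Solver.solve-∀
... | no a≰1+y with Y , refl ← <⇒∃-+-suc (≰⇒> a≰1+y) = x , y , X , Y , box refl refl n≡

lincomb-negʳ≡⊖ : ∀ x y → + x ℤ.* + a ℤ.+ -[1+ y ] ℤ.* + b ≡ (x * a) ⊖ (suc y * b)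
lincomb-negʳ≡⊖ {a} {b} x y = begin
  + x ℤ.* + a ℤ.+ -[1+ y ] ℤ.* + b
    ≡⟨ cong₂ ℤ._+_ (ℤ.pos-* x a) (ℤ.neg-distribˡ-* (+ suc y) (+ b)) ⟨
  + (x * a) ℤ.+ ℤ.- (+ suc y ℤ.* + b)  ≡⟨ cong (λ m → + (x * a) ℤ.+ ℤ.- m) (ℤ.pos-* (suc y) b) ⟨
  + (x * a) ℤ.+ ℤ.- + (suc y * b)      ≡⟨ ℤ.m-n≡m⊖n (x * a) (suc y * b) ⟩
  (x * a) ⊖ (suc y * b)                ∎
  where open ≡-Reasoning

Frobenius⇒InteriorBox : 0 < b → Frobenius a b n →
  ∀ u v → n ≡ u ℤ.* + a ℤ.+ v ℤ.* + b → InteriorBox a b n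
Frobenius⇒InteriorBox {b} {a} {n} z<s (¬pos , ¬neg) u v n≡ = classify (u /ℕ b ℤ.* + a ℤ.+ v) reduced
  where
  regroup : ∀ r t a v b → (r ℤ.+ t ℤ.* b) ℤ.* a ℤ.+ v ℤ.* b ≡ r ℤ.* a ℤ.+ (t ℤ.* a ℤ.+ v) ℤ.* b
  regroup = ℤ-Solver.solve-∀
  reduced : n ≡ + (u %ℕ b) ℤ.* + a ℤ.+ (u /ℕ b ℤ.* + a ℤ.+ v) ℤ.* + b
  reduced = trans n≡ (trans (cong (λ u → u ℤ.* + a ℤ.+ v ℤ.* + b) (a≡a%ℕn+[a/ℕn]*n u b))
                            (regroup (+ (u %ℕ b)) (u /ℕ b) (+ a) v (+ b)))
  classify : ∀ w → n ≡ + (u %ℕ b) ℤ.* + a ℤ.+ w ℤ.* + b → InteriorBox a b n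
  classify (+ w)    n≡ = contradiction (u %ℕ b , w , n≡) ¬pos
  classify -[1+ y ] n≡ =
    xa-yb⇒InteriorBox {y = y} ¬neg (n%ℕd<d u b) (trans n≡ (lincomb-negʳ≡⊖ (u %ℕ b) y))

-- Maximal Frobenius values are dead ends

Frobenius-neg : Frobenius a b n → Frobenius a b (ℤ.- n)
Frobenius-neg {a} {b} {n} (¬pos , ¬neg) =
  (λ pos → ¬neg (subst (NegGen a b) (ℤ.neg-involutive n) (PosGen⇒NegGen-neg pos))) ,
  (λ neg → ¬pos (subst (PosGen a b) (ℤ.neg-involutive n) (NegGen⇒PosGen-neg neg)))

MaximalFrobenius-neg : MaximalFrobenius a b n → MaximalFrobenius a b (ℤ.- n)
MaximalFrobenius-neg {a} {b} {n} (frobenius , maximal) =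
  Frobenius-neg frobenius , λ m frobenius′ m≢-n n≤m →
  maximal (ℤ.- m) (Frobenius-neg frobenius′)
    (λ -m≡n → m≢-n (trans (sym (ℤ.neg-involutive m)) (cong ℤ.-_ -m≡n)))
    (subst (λ k → CayleyLe a b k (ℤ.- m)) (ℤ.neg-involutive n) (CayleyLe-neg n≤m))

MaximalFrobenius-no-longer-step : 0 < a → 0 < b → MaximalFrobenius a b n →
  WordLength a b n k → Gen a b g →  Frobenius a b (n ℤ.+ g) → ¬ WordLength a b (n ℤ.+ g) (suc k)
MaximalFrobenius-no-longer-step {n = n} {g = g} 0<a 0<b (_ , maximal) geodesic g∈ frob geodesic′ =
  maximal (n ℤ.+ g) frob (Gen⇒≢0 0<a 0<b g∈ ∘ identityʳ-unique n g)
    (CayleyLe-step geodesic g∈ geodesic′)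

box-wordLength-≤ : Coprime a b → 0 < a → 0 < b → IsBox a b n x y X Y → x + y ≤ X + Y →
  WordLength a b n (x + y)
box-wordLength-≤ {a} {b} {n} coprime 0<a 0<b is-box u≤v =
  subst (WordLength a b n) (m≤n⇒m⊓n≡m u≤v) (box-wordLength coprime 0<a 0<b is-box)

MaximalFrobenius-unbalanced : Coprime a b → 0 < a → 0 < b → MaximalFrobenius a b n →
  IsBox a b n (suc x) (suc y) (suc X) (suc Y) → ¬ (suc (suc x + suc y) < suc X + suc Y)
MaximalFrobenius-unbalanced {a} {b} {n} {x} {y} {suc X} {Y} coprime 0<a 0<b mf is-box unbalanced =
  MaximalFrobenius-no-longer-step 0<a 0<b mf geodesic +a (IsBox⇒Frobenius coprime next)
    (box-wordLength-≤ coprime 0<a 0<b next (≤-pred unbalanced))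
  where
  geodesic : WordLength a b n (suc x + suc y)
  geodesic = box-wordLength-≤ coprime 0<a 0<b is-box (≤-trans (m≤n+m _ 2) unbalanced)
  next : IsBox a b (n ℤ.+ + a) (suc (suc x)) (suc y) (suc X) (suc Y)
  next = IsBox-+a is-box
MaximalFrobenius-unbalanced {a} {b} {n} {x} {y} {zero} {suc Y} coprime 0<a 0<b mf is-box unbalanced
  =
  MaximalFrobenius-no-longer-step 0<a 0<b mf geodesic -b (IsBox⇒Frobenius coprime next)
    (subst (WordLength a b _) (+-suc (suc x) (suc y)) (box-wordLength-≤ coprime 0<a 0<b next
      (subst (_≤ 2 + Y) (sym (+-suc (suc x) (suc y))) (≤-pred unbalanced))))
  where
  geodesic : WordLength a b n (suc x + suc y)
  geodesic = box-wordLength-≤ coprime 0<a 0<b is-box (≤-trans (m≤n+m _ 2) unbalanced)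
  next : IsBox a b (n ℤ.+ ℤ.- (+ b)) (suc x) (suc (suc y)) 1 (suc Y)
  next = IsBox--b is-box
MaximalFrobenius-unbalanced {X = zero} {zero} _ _ _ _ _ (s≤s (s≤s ()))

MaximalFrobenius-balanced : Coprime a b → 0 < a → 0 < b → MaximalFrobenius a b n →
  IsBox a b n (suc x) (suc y) (suc X) (suc Y) → suc X + suc Y ≤ suc (suc x + suc y)
MaximalFrobenius-balanced coprime 0<a 0<b mf is-box =
  ≮⇒≥ (MaximalFrobenius-unbalanced coprime 0<a 0<b mf is-box)

⊓-shift-≤ : ∀ {u v u′ v′} → u′ ≡ suc u → v ≡ suc v′ → v ≤ suc u → u′ ⊓ v′ ≤ u ⊓ v
⊓-shift-≤ {u} {v′ = v′} refl refl v≤1+u =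
  ⊓-glb (≤-trans (m⊓n≤n (suc u) v′) (≤-pred v≤1+u)) (≤-trans (m⊓n≤n (suc u) v′) (n≤1+n v′))

box-step-shortens : ∀ {x′ y′ X′ Y′} → Coprime a b → 0 < a → 0 < b →
  IsBox a b n x y X Y → IsBox a b m x′ y′ X′ Y′ →
  x′ + y′ ≡ suc (x + y) → X + Y ≡ suc (X′ + Y′) → X + Y ≤ suc (x + y) →
  WordLength a b n k → WordLength a b m k′ → k′ ≤ k
box-step-shortens coprime 0<a 0<b is-box is-box′ u′≡ v≡ balanced geodesic geodesic′ =
  subst₂ _≤_ (WordLength-unique (box-wordLength coprime 0<a 0<b is-box′) geodesic′)
             (WordLength-unique (box-wordLength coprime 0<a 0<b is-box) geodesic)
             (⊓-shift-≤ u′≡ v≡ balanced)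

HasWord⇒InteriorBox : 0 < b → Frobenius a b n → HasWord a b k n → InteriorBox a b n
HasWord⇒InteriorBox 0<b frobenius word with u , v , n≡ ← HasWord⇒lincomb word =
  Frobenius⇒InteriorBox 0<b frobenius u v n≡

MaximalFrobenius-+a-shortens : Coprime a b → 0 < a → 0 < b → MaximalFrobenius a b n →
  WordLength a b n k → WordLength a b (n ℤ.+ + a) k′ → k′ ≤ k
MaximalFrobenius-+a-shortens coprime 0<a 0<b mf geodesic geodesic′
  with x , y , X , Y , is-box ← HasWord⇒InteriorBox 0<b (proj₁ mf) (proj₁ geodesic) =
  box-step-shortens coprime 0<a 0<b is-box (IsBox-+a is-box) refl refl
    (MaximalFrobenius-balanced coprime 0<a 0<b mf is-box) geodesic geodesic′

MaximalFrobenius--b-shortens : Coprime a b → 0 < a → 0 < b → MaximalFrobenius a b n →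
  WordLength a b n k → WordLength a b (n ℤ.+ ℤ.- (+ b)) k′ → k′ ≤ k
MaximalFrobenius--b-shortens coprime 0<a 0<b mf geodesic geodesic′
  with x , y , X , Y , is-box ← HasWord⇒InteriorBox 0<b (proj₁ mf) (proj₁ geodesic) =
  box-step-shortens coprime 0<a 0<b is-box (IsBox--b is-box)
    (+-suc (suc x) (suc y)) (+-suc (suc X) Y)
    (MaximalFrobenius-balanced coprime 0<a 0<b mf is-box) geodesic geodesic′

MaximalFrobenius⇒DeadEnd : Coprime a b → 0 < a → 0 < b → MaximalFrobenius a b n → DeadEnd a b n
MaximalFrobenius⇒DeadEnd coprime 0<a 0<b mf _ +a _ _ geodesic geodesic′ =
  MaximalFrobenius-+a-shortens coprime 0<a 0<b mf geodesic geodesic′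
MaximalFrobenius⇒DeadEnd coprime 0<a 0<b mf _ -b _ _ geodesic geodesic′ =
  MaximalFrobenius--b-shortens coprime 0<a 0<b mf geodesic geodesic′
MaximalFrobenius⇒DeadEnd {a} {b} {n} coprime 0<a 0<b mf _ -a _ k′ geodesic geodesic′ =
  MaximalFrobenius-+a-shortens coprime 0<a 0<b (MaximalFrobenius-neg mf) (WordLength-neg geodesic)
    (subst (λ m → WordLength a b m k′) -[n-a]≡-n+a (WordLength-neg geodesic′))
  where
  -[n-a]≡-n+a : ℤ.- (n ℤ.+ ℤ.- (+ a)) ≡ ℤ.- n ℤ.+ + a
  -[n-a]≡-n+a =
    trans (ℤ.neg-distrib-+ n (ℤ.- (+ a))) (cong (ℤ._+_ (ℤ.- n)) (ℤ.neg-involutive (+ a)))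
MaximalFrobenius⇒DeadEnd {a} {b} {n} coprime 0<a 0<b mf _ +b _ k′ geodesic geodesic′ =
  MaximalFrobenius--b-shortens coprime 0<a 0<b (MaximalFrobenius-neg mf) (WordLength-neg geodesic)
    (subst (λ m → WordLength a b m k′) (ℤ.neg-distrib-+ n (+ b)) (WordLength-neg geodesic′))

theorem1 : (a b : ℕ) → 0 < a → 0 < b → gcd a b ≡ 1 →
    (d : ℤ) → DeadEnd a b d ⇔ MaximalFrobenius a b d
theorem1 a b 0<a 0<b gcd≡1 d = mk⇔
  (DeadEnd⇒MaximalFrobenius 0<a 0<b)
  (MaximalFrobenius⇒DeadEnd (gcd≡1⇒coprime gcd≡1) 0<a 0<b)
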